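{- Let $\mathcal A=\langle Q,\Sigma,\Delta,\mathcal R\rangle$ be a tagged TA whose language consists of tagged $n$-qubit trees, and let $v\in\{\omega,\frac1{\sqrt2}\}$. Let $\mathsf{Mult}(\mathcal A,v)$ be the TA obtained from $\mathcal A$ by replacing every leaf transition $q\xrightarrow{(a,b,c,d,k)}()$ by $q\xrightarrow{(-d,a,b,c,k)}()$ if $v=\omega$, and by $q\xrightarrow{(a,b,c,d,k+1)}()$ if $v=\frac1{\sqrt2}$ (internal transitions, states and root states unchanged). Then $\mathsf{Mult}(\mathcal A,v)\simeq_{\mathrm{Tag}}\mathcal A$ and $\mathcal L(\mathsf{Mult}(\mathcal A,v))=\{v\cdot T\mid T\in\mathcal L(\mathcal A)\}$.
   Context: Tree automata: a TA is $\mathcal A=\langle Q,\Sigma,\Delta,\mathcal R\rangle$ with finite state set $Q$, ranked alphabet $\Sigma$ of binary and constant symbols, root states $\mathcal R\subseteq Q$, and transitions that are internal $q\xrightarrow{f}(q_0,q_1)$ or leaf $q\xrightarrow{c}()$. It is assumed no state has leaf transitions with two different constants. A run on a binary tree labels each node with a state so that each leaf labelled $c$ with state $q$ has $q\xrightarrow{c}()\in\Delta$ and each internal node labelled $f$ with state $q$ and children states $q_0$ (left), $q_1$ (right) has $q\xrightarrow{f}(q_0,q_1)\in\Delta$; accepting if the root state is in $\mathcal R$; $\mathcal L(\mathcal A)$ is the set of trees with an accepting run. Leaf symbols are tuples $(a,b,c,d,k)\in\mathbb Z^5$ representing $(1/\sqrt2)^k(a+b\omega+c\omega^2+d\omega^3)$,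 $\omega=e^{i\pi/4}$. A tagged TA has binary symbols $x_k^j$ with distinct internal transitions carrying distinct symbols. A tagged $n$-qubit tree is a full binary tree of height $n$ whose internal nodes at depth $k-1$ are labelled by symbols $x_k^j$ and whose leaves are labelled in $\mathbb Z^5$. $v\cdot T$ is the tree with the same internal labels as $T$ whose every leaf label is replaced by the tuple $(-d,a,b,c,k)$ (if $v=\omega$) or $(a,b,c,d,k+1)$ (if $v=\frac1{\sqrt2}$), where $(a,b,c,d,k)$ is the original label (these represent the products with $v$). $\mathrm{Tag}(T)$ replaces every leaf label by a special symbol $\square$. $\mathcal B\simeq_{\mathrm{Tag}}\mathcal A$ means there is a bijection $S:\mathcal L(\mathcal A)\to\mathcal L(\mathcal B)$ with $\mathrm{Tag}(S(T))=\mathrm{Tag}(T)$ for all $T$. -}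

module Defs where

open import Data.Nat using (ℕ; zero; suc)
open import Data.Integer using (ℤ; -_) renaming (suc to sucℤ)
open import Data.Fin using (Fin)
open import Data.List using (List; map)
open import Data.List.Membership.Propositional using (_∈_)
open import Data.Product using (_×_; _,_; Σ; ∃; ∃-syntax)
open import Data.Unit using (⊤; tt)
open import Relation.Binary.PropositionalEquality using (_≡_)

-- Binary (tagged) symbols x_k^j are represented by the pair (k , j).
Sym : Set
Sym = ℕ × ℕ

-- Leaf symbols (a , b , c , d , k) ∈ ℤ⁵, representing
-- (1/√2)^k (a + bω + cω² + dω³).
Leaf : Set
Leaf = ℤ × ℤ × ℤ × ℤ × ℤ

data Tree (L : Set) : Set where
  leaf : L → Tree L
  node : Sym → Tree L → Tree L → Tree L

mapLeaves : {L M : Set} → (L → M) → Tree L → Tree M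
mapLeaves g (leaf c) = leaf (g c)
mapLeaves g (node f t₀ t₁) = node f (mapLeaves g t₀) (mapLeaves g t₁)

-- Tag(T): replace every leaf label by the special symbol □ (here tt : ⊤).
Tag : Tree Leaf → Tree ⊤
Tag = mapLeaves (λ _ → tt)

-- Tagged k-rooted qubit trees: QubitTree k h T says T is a full binary tree of
-- height h whose root is labelled x_k^j (for some j), its children x_{k+1}^j', etc.
data QubitTree : ℕ → ℕ → Tree Leaf → Set where
  leafQ : ∀ {k c} → QubitTree k zero (leaf c)
  nodeQ : ∀ {k h j t₀ t₁} → QubitTree (suc k) h t₀ → QubitTree (suc k) h t₁ →
          QubitTree k (suc h) (node (k , j) t₀ t₁)

-- A tagged n-qubit tree: internal nodes at depth k-1 are labelled x_k^j.
TaggedQubitTree : ℕ → Tree Leaf → Set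
TaggedQubitTree n T = QubitTree 1 n T

record TA : Set where
  field
    nQ       : ℕ
    internal : List (Fin nQ × Sym × Fin nQ × Fin nQ)
    leaves   : List (Fin nQ × Leaf)
    roots    : List (Fin nQ)
open TA public

data Run (A : TA) : Fin (nQ A) → Tree Leaf → Set where
  leafR : ∀ {q c} → (q , c) ∈ leaves A → Run A q (leaf c)
  nodeR : ∀ {q f q₀ q₁ t₀ t₁} → (q , f , q₀ , q₁) ∈ internal A →
          Run A q₀ t₀ → Run A q₁ t₁ → Run A q (node f t₀ t₁)

InLang : TA → Tree Leaf → Set
InLang A T = ∃[ q ] (q ∈ roots A × Run A q T)

LeafDeterministic : TA → Set
LeafDeterministic A = ∀ {q c c'} → (q , c) ∈ leaves A → (q , c') ∈ leaves A → c ≡ c'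

Tagged : TA → Set
Tagged A = ∀ {q f q₀ q₁ q' q₀' q₁'} →
  (q , f , q₀ , q₁) ∈ internal A → (q' , f , q₀' , q₁') ∈ internal A →
  (q , f , q₀ , q₁) ≡ (q' , f , q₀' , q₁')

data Scalar : Set where
  ω        : Scalar
  invSqrt2 : Scalar

mulLeaf : Scalar → Leaf → Leaf
mulLeaf ω        (a , b , c , d , k) = (- d , a , b , c , k)
mulLeaf invSqrt2 (a , b , c , d , k) = (a , b , c , d , sucℤ k)

_·_ : Scalar → Tree Leaf → Tree Leaf
v · T = mapLeaves (mulLeaf v) T

Mult : TA → Scalar → TA
Mult A v = record
  { nQ = nQ A
  ; internal = internal A
  ; leaves = map (λ { (q , c) → (q , mulLeaf v c) }) (leaves A)
  ; roots = roots A }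

-- The bijection between the subsets L(A), L(B) of trees is given by a function
-- on trees that maps L(A) into L(B), is injective on L(A) and onto L(B).
_≃Tag_ : TA → TA → Set
B ≃Tag A = Σ (Tree Leaf → Tree Leaf) λ S →
    (∀ T → InLang A T → InLang B (S T))
  × (∀ T T' → InLang A T → InLang A T' → S T ≡ S T' → T ≡ T')
  × (∀ U → InLang B U → ∃[ T ] (InLang A T × S T ≡ U))
  × (∀ T → InLang A T → Tag (S T) ≡ Tag T)

-- Multiplying by v acts on leaf labels only, through the injective map mulLeaf v.
-- Hence the runs of Mult(A, v) are exactly the runs of A with their leaves
-- relabelled, so L(Mult(A, v)) = v · L(A), and T ↦ v · T is a bijection between
-- the two languages that leaves the internal structure, i.e. Tag, unchanged.
module Submission where

open import Defs
open import Data.Nat using (ℕ)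
open import Data.Integer using (-_; pred)
open import Data.Integer.Properties using (neg-involutive; pred-suc)
open import Data.List using (map)
open import Data.List.Membership.Propositional.Properties using (∈-map⁺; ∈-map⁻)
open import Data.Product using (_×_; _,_; ∃-syntax)
open import Function.Bundles using (_⇔_; mk⇔)
open import Function.Definitions using (Injective)
open import Relation.Binary.PropositionalEquality using (_≡_; refl; sym; cong; cong₂; module ≡-Reasoning)

divLeaf : Scalar → Leaf → Leaf
divLeaf ω        (a , b , c , d , k) = (b , c , d , - a , k)
divLeaf invSqrt2 (a , b , c , d , k) = (a , b , c , d , pred k)

divLeaf-mulLeaf : ∀ v c → divLeaf v (mulLeaf v c) ≡ c
divLeaf-mulLeaf ω        (a , b , c , d , k) = cong (λ d′ → (a , b , c , d′ , k)) (neg-involutive d)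
divLeaf-mulLeaf invSqrt2 (a , b , c , d , k) = cong (λ k′ → (a , b , c , d , k′)) (pred-suc k)

mulLeaf-injective : ∀ v → Injective _≡_ _≡_ (mulLeaf v)
mulLeaf-injective v {c} {c′} e = begin
  c                        ≡⟨ divLeaf-mulLeaf v c ⟨
  divLeaf v (mulLeaf v c)  ≡⟨ cong (divLeaf v) e ⟩
  divLeaf v (mulLeaf v c′) ≡⟨ divLeaf-mulLeaf v c′ ⟩
  c′                       ∎
  where open ≡-Reasoning

module _ {L : Set} where

  leaf-injective : ∀ {c c′ : L} → leaf c ≡ leaf c′ → c ≡ c′
  leaf-injective refl = refl

  node-injective : ∀ {f f′} {t₀ t₁ t₀′ t₁′ : Tree L} →
    node f t₀ t₁ ≡ node f′ t₀′ t₁′ → f ≡ f′ × t₀ ≡ t₀′ × t₁ ≡ t₁′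
  node-injective refl = refl , refl , refl

mapLeaves-injective : {L M : Set} {g : L → M} →
  Injective _≡_ _≡_ g → Injective _≡_ _≡_ (mapLeaves g)
mapLeaves-injective g-inj {leaf c}       {leaf c′} e = cong leaf (g-inj (leaf-injective e))
mapLeaves-injective g-inj {node f t₀ t₁} {node f′ t₀′ t₁′} e with node-injective e
... | refl , e₀ , e₁ = cong₂ (node f) (mapLeaves-injective g-inj e₀) (mapLeaves-injective g-inj e₁)

Tag-mapLeaves : (g : Leaf → Leaf) (T : Tree Leaf) → Tag (mapLeaves g T) ≡ Tag T
Tag-mapLeaves g (leaf c)       = refl
Tag-mapLeaves g (node f t₀ t₁) = cong₂ (node f) (Tag-mapLeaves g t₀) (Tag-mapLeaves g t₁)

-- Mult A v is definitionally relabelLeaves (mulLeaf v) A.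
relabelLeaves : (Leaf → Leaf) → TA → TA
relabelLeaves g A = record
  { nQ = nQ A
  ; internal = internal A
  ; leaves = map (λ { (q , c) → (q , g c) }) (leaves A)
  ; roots = roots A }

module _ (g : Leaf → Leaf) (A : TA) where

  run-relabelLeaves : ∀ {q T} → Run A q T → Run (relabelLeaves g A) q (mapLeaves g T)
  run-relabelLeaves (leafR m)       = leafR (∈-map⁺ _ m)
  run-relabelLeaves (nodeR m r₀ r₁) = nodeR m (run-relabelLeaves r₀) (run-relabelLeaves r₁)

  run-relabelLeaves⁻ : ∀ {q U} → Run (relabelLeaves g A) q U →
    ∃[ T ] (Run A q T × U ≡ mapLeaves g T)
  run-relabelLeaves⁻ (leafR m) with ∈-map⁻ _ m
  ... | (_ , c) , m′ , refl = leaf c , leafR m′ , refl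
  run-relabelLeaves⁻ {U = node f _ _} (nodeR m r₀ r₁)
    with run-relabelLeaves⁻ r₀ | run-relabelLeaves⁻ r₁
  ... | t₀ , s₀ , refl | t₁ , s₁ , refl = node f t₀ t₁ , nodeR m s₀ s₁ , refl

  inLang-relabelLeaves : ∀ {T} → InLang A T → InLang (relabelLeaves g A) (mapLeaves g T)
  inLang-relabelLeaves (q , q∈R , r) = q , q∈R , run-relabelLeaves r

  inLang-relabelLeaves⁻ : ∀ {U} → InLang (relabelLeaves g A) U →
    ∃[ T ] (InLang A T × U ≡ mapLeaves g T)
  inLang-relabelLeaves⁻ (q , q∈R , r) with run-relabelLeaves⁻ r
  ... | T , s , U≡gT = T , (q , q∈R , s) , U≡gT

  inLang-relabelLeaves⇔ : ∀ U →
    InLang (relabelLeaves g A) U ⇔ (∃[ T ] (InLang A T × U ≡ mapLeaves g T))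
  inLang-relabelLeaves⇔ U = mk⇔ inLang-relabelLeaves⁻ λ { (T , T∈L , refl) → inLang-relabelLeaves T∈L }

  relabelLeaves-≃Tag : Injective _≡_ _≡_ g → relabelLeaves g A ≃Tag A
  relabelLeaves-≃Tag g-inj =
      mapLeaves g
    , (λ _ → inLang-relabelLeaves)
    , (λ _ _ _ _ → mapLeaves-injective g-inj)
    , (λ _ U∈L → onto (inLang-relabelLeaves⁻ U∈L))
    , (λ T _ → Tag-mapLeaves g T)
    where
    onto : ∀ {U} → ∃[ T ] (InLang A T × U ≡ mapLeaves g T) → ∃[ T ] (InLang A T × mapLeaves g T ≡ U)
    onto (T , T∈L , U≡gT) = T , T∈L , sym U≡gT

theorem6p7 : (A : TA) (n : ℕ) (v : Scalar) →
    LeafDeterministic A → Tagged A →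
    (∀ T → InLang A T → TaggedQubitTree n T) →
    (Mult A v ≃Tag A)
    × (∀ U → InLang (Mult A v) U ⇔ (∃[ T ] (InLang A T × U ≡ v · T)))
theorem6p7 A _ v _ _ _ =
    relabelLeaves-≃Tag (mulLeaf v) A (mulLeaf-injective v)
  , inLang-relabelLeaves⇔ (mulLeaf v) A
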